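{- Let $n$ be a positive integer and $S$ a packing sequence with $s_1=1$. (i) For the path $P_n\colon v_1\dots v_n$ there exists an $S$-packing coloring using exactly $\chi_S(P_n)$ colors that assigns color $1$ to every vertex $v_i$ with odd index $i$. (ii) If $S=(1,s_2,\ldots)$ and $S'=(s_1',s_2',\ldots)$ are packing sequences such that $s_i'=\lfloor s_{i+1}/2\rfloor$ for every positive integer $i$, then for every $n\ge 2$, $$\chi_S(P_n)=\chi_{S'}(P_{\lfloor n/2\rfloor})+1.$$
   Context: A packing sequence is a non-decreasing infinite sequence $S=(s_1,s_2,\ldots)$ of positive integers. For a graph $G$, a map $\phi\colon V(G)\to\{1,\ldots,k\}$ is an $S$-packing $k$-coloring if any two distinct vertices $u,v$ with $\phi(u)=\phi(v)=i$ satisfy $d_G(u,v) > s_i$; $\chi_S(G)$ is the least such $k$. $P_n$ is the path on $n$ vertices. -}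

module Defs where

open import Data.Nat using (ℕ; zero; suc; _≤_; _<_; ∣_-_∣)
open import Data.Fin using (Fin; toℕ)
open import Data.Product using (Σ; _×_)
open import Relation.Binary.PropositionalEquality using (_≡_; _≢_)
open import Relation.Nullary using (¬_)

-- A packing sequence S = (s_1, s_2, ...), stored 0-based:
-- seq i  is  s_{i+1}.
record PackingSequence : Set where
  field
    seq      : ℕ → ℕ
    positive : ∀ i → 1 ≤ seq i
    nondecr  : ∀ i → seq i ≤ seq (suc i)
open PackingSequence public

-- The path P_n : v_1 ... v_n, vertex v_{i+1} represented by i : Fin n.
-- Its graph distance: d(v_i, v_j) = |i - j|.
pathDist : {n : ℕ} → Fin n → Fin n → ℕ
pathDist u v = ∣ toℕ u - toℕ v ∣

-- An S-packing k-coloring of P_n; colour c : Fin k stands for colour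
-- toℕ c + 1 ∈ {1,…,k}, whose distance bound is s_{toℕ c + 1} = seq S (toℕ c).
IsPackingColoring : (S : PackingSequence) (n k : ℕ) → (Fin n → Fin k) → Set
IsPackingColoring S n k φ =
  ∀ u v → u ≢ v → φ u ≡ φ v → seq S (toℕ (φ u)) < pathDist u v

HasPackingColoring : PackingSequence → ℕ → ℕ → Set
HasPackingColoring S n k = Σ (Fin n → Fin k) (IsPackingColoring S n k)

IsPackingChromatic : PackingSequence → ℕ → ℕ → Set
IsPackingChromatic S n k =
  HasPackingColoring S n k × (∀ j → j < k → ¬ HasPackingColoring S n j)

{-# OPTIONS --safe #-}
-- Since s₁ = 1, colour 1 never sits on two adjacent vertices, so the vertices of any
-- other colour, listed from left to right, start at v₁ or v₂ and advance by 1 or 2;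
-- there are at least ⌊n/2⌋ of them. Moving the j-th of them to the j-th vertex of
-- P_⌊n/2⌋ and lowering every colour by one at most halves distances, which gives an
-- S′-packing colouring with one colour fewer. Conversely, an S′-packing colouring of
-- P_⌊n/2⌋, raised by one colour and placed on v₂, v₄, …, with colour 1 on the odd
-- vertices, is an S-packing colouring of P_n: distances double. Both constructions
-- together give (ii), and their composite is the colouring required in (i).
module Submission where

open import Defs
open import Data.Nat
  using (ℕ; zero; suc; pred; _+_; _*_; _∸_; _≤_; _<_; _/_; _%_; ∣_-_∣; NonZero; ≢-nonZero;
         z≤n; s≤s; _≟_; _<?_)
open import Data.Nat.Properties
open import Data.Nat.DivMod using (m*n/n≡m; m/n*n≤m; /-monoˡ-≤; m<n*o⇒m/o<n; [m+kn]%n≡m%n)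
open import Data.Fin using (Fin; toℕ; fromℕ<)
open import Data.Fin.Properties using (¬Fin0; toℕ-fromℕ<; toℕ-injective; toℕ<n)
open import Data.Product using (Σ; _×_; _,_; proj₁; proj₂)
open import Data.Sum using (inj₁; inj₂)
open import Function using (_∘_)
open import Relation.Nullary using (yes; no; contradiction)
open import Relation.Binary.PropositionalEquality

m*o≤n⇒m≤n/o : ∀ {m n} o .{{_ : NonZero o}} → m * o ≤ n → m ≤ n / o
m*o≤n⇒m≤n/o {m} o h = subst (_≤ _ / o) (m*n/n≡m m o) (/-monoˡ-≤ o h)

m≤n/o⇒m*o≤n : ∀ {m n} o .{{_ : NonZero o}} → m ≤ n / o → m * o ≤ n
m≤n/o⇒m*o≤n {n = n} o h = ≤-trans (*-monoˡ-≤ o h) (m/n*n≤m n o)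

m/o<n⇒m<n*o : ∀ {m n} o .{{_ : NonZero o}} → m / o < n → m < n * o
m/o<n⇒m<n*o o h = ≰⇒> (<⇒≱ h ∘ m*o≤n⇒m≤n/o o)

≢⇒0<∣-∣ : ∀ {m n} → m ≢ n → 0 < ∣ m - n ∣
≢⇒0<∣-∣ m≢n = n≢0⇒n>0 (m≢n ∘ ∣m-n∣≡0⇒m≡n)

∣m-1+m∣≡1 : ∀ m → ∣ m - suc m ∣ ≡ 1
∣m-1+m∣≡1 m = trans (m≤n⇒∣m-n∣≡n∸m (n≤1+n m)) (m+n∸n≡m 1 m)

nonzero-pred< : ∀ {m n} → m ≢ 0 → m < suc n → pred m < n
nonzero-pred< {zero}  m≢0 _         = contradiction refl m≢0
nonzero-pred< {suc m} _   (s≤s m<n) = m<n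

data EvenOdd : ℕ → Set where
  even : ∀ m → EvenOdd (m * 2)
  odd  : ∀ m → EvenOdd (suc (m * 2))

evenOdd : ∀ n → EvenOdd n
evenOdd zero = even 0
evenOdd (suc n) with evenOdd n
... | even m = odd m
... | odd m  = even (suc m)

module StepsOfOneOrTwo {p : ℕ → ℕ}
  (step : ∀ j → suc (p j) ≤ p (suc j) × p (suc j) ≤ 2 + p j) where

  spread : ∀ a d → d + p a ≤ p (d + a) × p (d + a) ≤ d * 2 + p a
  spread a zero    = ≤-refl , ≤-refl
  spread a (suc d) =
    ≤-trans (s≤s (proj₁ (spread a d))) (proj₁ (step (d + a))) ,
    ≤-trans (proj₂ (step (d + a))) (s≤s (s≤s (proj₂ (spread a d))))

  ∣-∣-bounds-≤ : ∀ {a b} → a ≤ b → ∣ a - b ∣ ≤ ∣ p a - p b ∣ × ∣ p a - p b ∣ ≤ ∣ a - b ∣ * 2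
  ∣-∣-bounds-≤ {a} {b} a≤b =
    subst₂ _≤_ (sym ∣a-b∣≡) (sym ∣pa-pb∣≡) (m+n≤o⇒m≤o∸n (b ∸ a) lower) ,
    subst₂ _≤_ (sym ∣pa-pb∣≡) (cong (_* 2) (sym ∣a-b∣≡))
      (m≤n+o⇒m∸n≤o (p b) (p a) (subst (p b ≤_) (+-comm _ (p a)) upper))
    where
    lower : b ∸ a + p a ≤ p b
    lower = subst (λ x → b ∸ a + p a ≤ p x) (m∸n+n≡m a≤b) (proj₁ (spread a (b ∸ a)))
    upper : p b ≤ (b ∸ a) * 2 + p a
    upper = subst (λ x → p x ≤ (b ∸ a) * 2 + p a) (m∸n+n≡m a≤b) (proj₂ (spread a (b ∸ a)))
    ∣a-b∣≡ : ∣ a - b ∣ ≡ b ∸ a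
    ∣a-b∣≡ = m≤n⇒∣m-n∣≡n∸m a≤b
    ∣pa-pb∣≡ : ∣ p a - p b ∣ ≡ p b ∸ p a
    ∣pa-pb∣≡ = m≤n⇒∣m-n∣≡n∸m (m+n≤o⇒n≤o (b ∸ a) lower)

  ∣-∣-bounds : ∀ a b → ∣ a - b ∣ ≤ ∣ p a - p b ∣ × ∣ p a - p b ∣ ≤ ∣ a - b ∣ * 2
  ∣-∣-bounds a b with ≤-total a b
  ... | inj₁ a≤b = ∣-∣-bounds-≤ a≤b
  ... | inj₂ b≤a rewrite ∣-∣-comm a b | ∣-∣-comm (p a) (p b) = ∣-∣-bounds-≤ b≤a

  injective : ∀ {a b} → a ≢ b → p a ≢ p b
  injective {a} {b} a≢b pa≡pb =
    <⇒≱ (≢⇒0<∣-∣ a≢b) (subst (∣ a - b ∣ ≤_) (m≡n⇒∣m-n∣≡0 pa≡pb) (proj₁ (∣-∣-bounds a b)))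

record PathColouring (t : ℕ → ℕ) (n k : ℕ) : Set where
  field
    colour    : ℕ → ℕ
    colour<k  : ∀ {i} → i < n → colour i < k
    separated : ∀ {i j} → i < n → j < n → i ≢ j → colour i ≡ colour j → t (colour i) < ∣ i - j ∣
open PathColouring

relax : ∀ {t t′ n k} → (∀ x → t′ x ≤ t x) → PathColouring t n k → PathColouring t′ n k
relax t′≤t C = record
  { colour    = colour C
  ; colour<k  = colour<k C
  ; separated = λ i<n j<n i≢j same → ≤-<-trans (t′≤t _) (separated C i<n j<n i≢j same)
  }

separated-adjacent : ∀ {t n k i} (C : PathColouring t n k) → suc i < n →
                     colour C i ≡ colour C (suc i) → t (colour C i) ≡ 0
separated-adjacent {t} {i = i} C 1+i<n same = n<1⇒n≡0 (subst (t (colour C i) <_) (∣m-1+m∣≡1 i)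
  (separated C (<-trans (n<1+n i) 1+i<n) 1+i<n (<⇒≢ (n<1+n i)) same))

module _ (S : PackingSequence) {n k : ℕ} where

  fromPackingColoring : HasPackingColoring S n k → PathColouring (seq S) n k
  fromPackingColoring (φ , φ-packing) = record
    { colour    = c
    ; colour<k  = λ i<n → subst (_< k) (sym (c-fromℕ< i<n)) (toℕ<n _)
    ; separated = separated′
    }
    where
    c : ℕ → ℕ
    c i with i <? n
    ... | yes i<n = toℕ (φ (fromℕ< i<n))
    ... | no _    = 0

    c-fromℕ< : ∀ {i} (i<n : i < n) → c i ≡ toℕ (φ (fromℕ< i<n))
    c-fromℕ< {i} i<n with i <? n
    ... | yes _    = refl
    ... | no i≮n   = contradiction i<n i≮n

    separated′ : ∀ {i j} → i < n → j < n → i ≢ j → c i ≡ c j → seq S (c i) < ∣ i - j ∣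
    separated′ {i} {j} i<n j<n i≢j same =
      subst₂ (λ x d → seq S x < d) (sym (c-fromℕ< i<n))
        (cong₂ ∣_-_∣ (toℕ-fromℕ< i<n) (toℕ-fromℕ< j<n))
        (φ-packing (fromℕ< i<n) (fromℕ< j<n)
          (i≢j ∘ λ e → trans (sym (toℕ-fromℕ< i<n)) (trans (cong toℕ e) (toℕ-fromℕ< j<n)))
          (toℕ-injective (trans (sym (c-fromℕ< i<n)) (trans same (c-fromℕ< j<n)))))

  restrict : PathColouring (seq S) n k → Fin n → Fin k
  restrict C u = fromℕ< (colour<k C (toℕ<n u))

  toℕ-restrict : ∀ C u → toℕ (restrict C u) ≡ colour C (toℕ u)
  toℕ-restrict C u = toℕ-fromℕ< (colour<k C (toℕ<n u))

  restrict-packing : ∀ C → IsPackingColoring S n k (restrict C)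
  restrict-packing C u v u≢v same =
    subst (λ x → seq S x < pathDist u v) (sym (toℕ-restrict C u))
      (separated C (toℕ<n u) (toℕ<n v) (u≢v ∘ toℕ-injective)
        (trans (sym (toℕ-restrict C u)) (trans (cong toℕ same) (toℕ-restrict C v))))

  toPackingColoring : PathColouring (seq S) n k → HasPackingColoring S n k
  toPackingColoring C = restrict C , restrict-packing C

-- The paper's S′ : s′ᵢ = ⌊s_{i+1}/2⌋ in the 0-based indexing of `seq`; a bare function,
-- since ⌊s_{i+1}/2⌋ may vanish and so need not form a packing sequence.
halved : (ℕ → ℕ) → ℕ → ℕ
halved t x = t (suc x) / 2

interleave : (ℕ → ℕ) → ℕ → ℕ
interleave c i with evenOdd i
... | even _ = 0
... | odd m  = suc (c m)

interleave-even : ∀ (c : ℕ → ℕ) i → i % 2 ≡ 0 → interleave c i ≡ 0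
interleave-even c i i%2≡0 with evenOdd i
... | even _ = refl
... | odd m  = contradiction (trans (sym ([m+kn]%n≡m%n 1 m 2)) i%2≡0) λ ()

expand : ∀ {t n k} → t 0 ≤ 1 → PathColouring (halved t) (n / 2) k → PathColouring t n (suc k)
expand {t} {n} {k} t0≤1 C = record
  { colour    = interleave (colour C)
  ; colour<k  = colour<k′
  ; separated = separated′
  }
  where
  colour<k′ : ∀ {i} → i < n → interleave (colour C) i < suc k
  colour<k′ {i} i<n with evenOdd i
  ... | even _ = s≤s z≤n
  ... | odd m  = s≤s (colour<k C (m*o≤n⇒m≤n/o 2 i<n))

  separated′ : ∀ {i j} → i < n → j < n → i ≢ j → interleave (colour C) i ≡ interleave (colour C) j →
               t (interleave (colour C) i) < ∣ i - j ∣
  separated′ {i} {j} i<n j<n i≢j same with evenOdd i | evenOdd j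
  ... | even a | even b = begin-strict
    t 0                 ≤⟨ t0≤1 ⟩
    1                   <⟨ *-monoˡ-≤ 2 (≢⇒0<∣-∣ {a} {b} (i≢j ∘ cong (_* 2))) ⟩
    ∣ a - b ∣ * 2       ≡⟨ *-distribʳ-∣-∣ 2 a b ⟩
    ∣ a * 2 - b * 2 ∣   ∎
    where open ≤-Reasoning
  ... | even _ | odd _  = contradiction same 0≢1+n
  ... | odd _  | even _ = contradiction (sym same) 0≢1+n
  ... | odd a  | odd b  = subst (_ <_) (*-distribʳ-∣-∣ 2 a b) (m/o<n⇒m<n*o 2
    (separated C (m*o≤n⇒m≤n/o 2 i<n) (m*o≤n⇒m≤n/o 2 j<n) (i≢j ∘ cong (suc ∘ (_* 2))) (suc-injective same)))

skipZero : (ℕ → ℕ) → ℕ → ℕ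
skipZero c i with c i ≟ 0
... | yes _ = suc i
... | no _  = i

skipZero-bounds : ∀ (c : ℕ → ℕ) i → i ≤ skipZero c i × skipZero c i ≤ suc i
skipZero-bounds c i with c i ≟ 0
... | yes _ = n≤1+n i , ≤-refl
... | no _  = ≤-refl , n≤1+n i

skipZero-nonzero : ∀ (c : ℕ → ℕ) i → (c i ≡ 0 → c (suc i) ≢ 0) → c (skipZero c i) ≢ 0
skipZero-nonzero c i no-adjacent-zeros with c i ≟ 0
... | yes ci≡0 = no-adjacent-zeros ci≡0
... | no ci≢0  = ci≢0

-- As long as c never takes the value 0 twice in a row, this lists the positions
-- where c is nonzero in increasing order.
nonzeroIndex : (ℕ → ℕ) → ℕ → ℕ
nonzeroIndex c zero    = skipZero c 0
nonzeroIndex c (suc j) = skipZero c (suc (nonzeroIndex c j))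

nonzeroIndex-step : ∀ (c : ℕ → ℕ) j → suc (nonzeroIndex c j) ≤ nonzeroIndex c (suc j) ×
                            nonzeroIndex c (suc j) ≤ 2 + nonzeroIndex c j
nonzeroIndex-step c j = skipZero-bounds c (suc (nonzeroIndex c j))

nonzeroIndex-≤ : ∀ (c : ℕ → ℕ) j → nonzeroIndex c j ≤ suc (j * 2)
nonzeroIndex-≤ c zero    = proj₂ (skipZero-bounds c 0)
nonzeroIndex-≤ c (suc j) = ≤-trans (proj₂ (nonzeroIndex-step c j)) (s≤s (s≤s (nonzeroIndex-≤ c j)))

nonzeroIndex-nonzero : ∀ {n} (c : ℕ → ℕ) → (∀ {i} → suc i < n → c i ≡ 0 → c (suc i) ≢ 0) →
                       ∀ j → suc (j * 2) < n → c (nonzeroIndex c j) ≢ 0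
nonzeroIndex-nonzero c no-adjacent-zeros zero    1<n = skipZero-nonzero c 0 (no-adjacent-zeros 1<n)
nonzeroIndex-nonzero c no-adjacent-zeros (suc j) h   = skipZero-nonzero c _
  (no-adjacent-zeros (≤-trans (s≤s (s≤s (s≤s (nonzeroIndex-≤ c j)))) h))

contract : ∀ {t n k} → 0 < t 0 → PathColouring t n (suc k) → PathColouring (halved t) (n / 2) k
contract {t} {n} {k} t0>0 C = record
  { colour    = pred ∘ c ∘ p
  ; colour<k  = λ j<n/2 → nonzero-pred< (nonzero j<n/2) (colour<k C (p< j<n/2))
  ; separated = separated′
  }
  where
  c : ℕ → ℕ
  c = colour C

  p : ℕ → ℕ
  p = nonzeroIndex c

  open StepsOfOneOrTwo (nonzeroIndex-step c)

  p< : ∀ {j} → j < n / 2 → p j < n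
  p< {j} j<n/2 = ≤-<-trans (nonzeroIndex-≤ c j) (m≤n/o⇒m*o≤n 2 j<n/2)

  no-adjacent-zeros : ∀ {i} → suc i < n → c i ≡ 0 → c (suc i) ≢ 0
  no-adjacent-zeros 1+i<n ci≡0 c1+i≡0 = <⇒≢ t0>0 (sym (subst (λ x → t x ≡ 0) ci≡0
    (separated-adjacent C 1+i<n (trans ci≡0 (sym c1+i≡0)))))

  nonzero : ∀ {j} → j < n / 2 → c (p j) ≢ 0
  nonzero {j} j<n/2 = nonzeroIndex-nonzero c no-adjacent-zeros j (m≤n/o⇒m*o≤n 2 j<n/2)

  separated′ : ∀ {a b} → a < n / 2 → b < n / 2 → a ≢ b → pred (c (p a)) ≡ pred (c (p b)) →
               halved t (pred (c (p a))) < ∣ a - b ∣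
  separated′ {a} {b} a<n/2 b<n/2 a≢b same = m<n*o⇒m/o<n (begin-strict
    t (suc (pred (c (p a))))   ≡⟨ cong t (suc-pred _ {{≢-nonZero (nonzero a<n/2)}}) ⟩
    t (c (p a))                <⟨ separated C (p< a<n/2) (p< b<n/2) (injective a≢b) same′ ⟩
    ∣ p a - p b ∣              ≤⟨ proj₂ (∣-∣-bounds a b) ⟩
    ∣ a - b ∣ * 2              ∎)
    where
    open ≤-Reasoning
    same′ : c (p a) ≡ c (p b)
    same′ = pred-injective {{≢-nonZero (nonzero a<n/2)}} {{≢-nonZero (nonzero b<n/2)}} same

chromatic-minimal : ∀ S {n k j} → IsPackingChromatic S n k → HasPackingColoring S n j → k ≤ j
chromatic-minimal _ (_ , below-k-impossible) φ = ≮⇒≥ λ j<k → below-k-impossible _ j<k φ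

colour-1-on-odd-vertices : ∀ S {n k} → seq S 0 ≡ 1 → 1 ≤ n → HasPackingColoring S n k →
  Σ (Fin n → Fin k) λ φ → IsPackingColoring S n k φ × (∀ v → toℕ v % 2 ≡ 0 → toℕ (φ v) ≡ 0)
colour-1-on-odd-vertices _ {k = zero}  _  1≤n (φ , _) = contradiction (φ (fromℕ< 1≤n)) ¬Fin0
colour-1-on-odd-vertices S {k = suc _} s0≡1 _ φ =
  restrict S C , restrict-packing S C ,
  λ v v-even → trans (toℕ-restrict S C v) (interleave-even _ (toℕ v) v-even)
  where
  C : PathColouring (seq S) _ _
  C = expand (≤-reflexive s0≡1) (contract (positive S 0) (fromPackingColoring S φ))

chromatic-halved : ∀ S S′ {n k k′} → seq S 0 ≡ 1 → (∀ i → seq S′ i ≡ halved (seq S) i) → 1 ≤ n →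
  IsPackingChromatic S n k → IsPackingChromatic S′ (n / 2) k′ → k ≡ suc k′
chromatic-halved _ _ {k = zero} _ _ 1≤n ((φ , _) , _) _ = contradiction (φ (fromℕ< 1≤n)) ¬Fin0
chromatic-halved S S′ {k = suc _} s0≡1 S′≡halved _ χ χ′ = ≤-antisym
  (chromatic-minimal S χ (toPackingColoring S (expand (≤-reflexive s0≡1)
    (relax (≤-reflexive ∘ sym ∘ S′≡halved) (fromPackingColoring S′ (proj₁ χ′))))))
  (s≤s (chromatic-minimal S′ χ′ (toPackingColoring S′ (relax (≤-reflexive ∘ S′≡halved)
    (contract (positive S 0) (fromPackingColoring S (proj₁ χ)))))))

lemma2p1 : (S : PackingSequence) → seq S 0 ≡ 1 →
    ((n : ℕ) → 1 ≤ n → (k : ℕ) → IsPackingChromatic S n k →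
      Σ (Fin n → Fin k) λ φ → IsPackingColoring S n k φ ×
        (∀ v → toℕ v % 2 ≡ 0 → toℕ (φ v) ≡ 0))
    × ((S' : PackingSequence) → (∀ i → seq S' i ≡ seq S (suc i) / 2) →
      (n : ℕ) → 2 ≤ n → (k k' : ℕ) →
      IsPackingChromatic S n k → IsPackingChromatic S' (n / 2) k' →
      k ≡ suc k')
lemma2p1 S s0≡1 =
  (λ n 1≤n k χ → colour-1-on-odd-vertices S s0≡1 1≤n (proj₁ χ)) ,
  (λ S′ S′≡halved n 2≤n k k′ → chromatic-halved S S′ s0≡1 S′≡halved (≤-trans (s≤s z≤n) 2≤n))
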